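{- Let $(t,u,z_0) \in \mathbb{Z}^3$ satisfy $t^2 - (z_0^2 + 3)u^2 = 1$, with $3 \nmid z_0$, $z_0^2 + 3$ square-free, and $u \neq 0$. Then $(t,u,z_0)$ does not lie on any $\mathbb{A}^1$-curve defined over $\mathbb{Z}$ on the surface $t^2 - (z^2+3)u^2 = 1$ in $\mathbb{A}^3$ with coordinates $(t,u,z)$.
   Context: An $\mathbb{A}^1$-curve defined over $\mathbb{Z}$ on this surface is the image of a non-constant polynomial map $x \mapsto (t(x),u(x),z(x))$ with $t,u,z \in \mathbb{Z}[x]$ such that $t(x)^2 - (z(x)^2+3)u(x)^2 = 1$ identically. -}

module Defs where

open import Data.Integer using (ℤ; _+_; _*_; -_; 0ℤ; 1ℤ)
open import Data.Integer.Divisibility using (_∣_)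
open import Data.List using (List; []; _∷_)
open import Data.Product using (Σ; ∃; _×_; _,_)
open import Data.Sum using (_⊎_)
open import Data.Unit using (⊤)
open import Relation.Binary.PropositionalEquality using (_≡_)
open import Relation.Nullary using (¬_)

-- Polynomials in ℤ[x] as coefficient lists, constant coefficient first.
Poly : Set
Poly = List ℤ

_⊕_ : Poly → Poly → Poly
[] ⊕ q = q
(a ∷ p) ⊕ [] = a ∷ p
(a ∷ p) ⊕ (b ∷ q) = (a + b) ∷ (p ⊕ q)

scale : ℤ → Poly → Poly
scale c [] = []
scale c (a ∷ p) = (c * a) ∷ scale c p

_⊗_ : Poly → Poly → Poly
[] ⊗ q = []
(a ∷ p) ⊗ q = scale a q ⊕ (0ℤ ∷ (p ⊗ q))

neg : Poly → Poly
neg = scale (- 1ℤ)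

const : ℤ → Poly
const c = c ∷ []

data IsZero : Poly → Set where
  nil  : IsZero []
  cons : ∀ {p} → IsZero p → IsZero (0ℤ ∷ p)

-- equality in ℤ[x] (equality of coefficients, ignoring trailing zeros)
_≈ₚ_ : Poly → Poly → Set
p ≈ₚ q = IsZero (p ⊕ neg q)

IsConstant : Poly → Set
IsConstant [] = ⊤
IsConstant (a ∷ p) = IsZero p

eval : Poly → ℤ → ℤ
eval [] x = 0ℤ
eval (a ∷ p) x = a + x * eval p x

disc : ℤ → ℤ
disc z = z * z + (1ℤ + 1ℤ + 1ℤ)

SquareFree : ℤ → Set
SquareFree n = ∀ (d : ℤ) → (d * d) ∣ n → (d ≡ 1ℤ ⊎ d ≡ - 1ℤ)

OnSurface : ℤ → ℤ → ℤ → Set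
OnSurface t u z = t * t + - (disc z * (u * u)) ≡ 1ℤ

-- An A¹-curve defined over ℤ on the surface: a non-constant polynomial map
-- x ↦ (t(x), u(x), z(x)) with t,u,z ∈ ℤ[x] and t² − (z²+3)u² = 1 in ℤ[x].
record A1Curve : Set where
  field
    tp up zp : Poly
    nonconst : ¬ (IsConstant tp × IsConstant up × IsConstant zp)
    onSurf : ((tp ⊗ tp) ⊕ neg (((zp ⊗ zp) ⊕ const (1ℤ + 1ℤ + 1ℤ)) ⊗ (up ⊗ up))) ≈ₚ const 1ℤ

LiesOn : ℤ → ℤ → ℤ → A1Curve → Set
LiesOn t u z C = ∃ λ (x₀ : ℤ) →
  (eval (A1Curve.tp C) x₀ ≡ t) × (eval (A1Curve.up C) x₀ ≡ u) × (eval (A1Curve.zp C) x₀ ≡ z)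

-- Write T, U, N for |t|, |u|, |z| at X ∈ ℕ, so that T² - (N² + 3) U² = 1 for every X.
-- If z is constant, D = z₀² + 3 is a fixed non-square (square-free and > 1); comparing growth forces
-- deg t = deg u, and then the leading coefficients a, b of t, u satisfy a² = D b², which is impossible.
-- If deg z = M ≥ 1, then deg t = K ≥ 1 since N < T.  Take X ≡ x₀ (mod 3) large, so that n = N(X) is
-- prime to 3, and work in ℤ[√D] with D = n² + 3: ε = T + U√D is a unit and β = n + √D has norm -3.
-- Both ε^M and β^K have size about X^(KM), and the resulting estimates force β^K / ε^M to be rational,
-- i.e. (im β^K)² = (-3)^K (im ε^M)², so 3 divides im β^K.  But im β^K ≡ (2n)^(K-1) (mod 3).

module Submission where

open import Defs
open import Data.Nat using (ℕ; zero; suc; _+_; _*_; _^_; _≤_; _<_; _⊔_; z≤n; s≤s; _≤?_; NonZero; ≢-nonZero; >-nonZero)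
open import Data.Nat.Properties
open import Data.Nat.Tactic.RingSolver using (solve-∀)
import Data.Nat.Divisibility as ℕ
open import Data.Nat.DivMod using (_/_; m/n*n≡m)
open import Data.Nat.GCD using (gcd; gcd[m,n]∣m; gcd[m,n]∣n; gcd[m,n]≢0)
open import Data.Nat.Coprimality using (Coprime; coprime-/gcd; coprime-divisor)
open import Data.Nat.Primality using (Prime; prime?; euclidsLemma)
import Data.Integer as ℤ
open ℤ using (ℤ; +_; -[1+_]; ∣_∣; 0ℤ; 1ℤ)
import Data.Integer.Properties as ℤ
import Data.Integer.Tactic.RingSolver as ℤ-Solver
open import Data.Integer.Divisibility using (_∣_)
import Data.Integer.Divisibility.Signed as ℤ∣
open import Data.List using ([]; _∷_)
open import Data.Product using (∃; _×_; _,_; proj₁; proj₂)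
open import Data.Sum using (_⊎_; inj₁; inj₂)
open import Data.Empty using (⊥; ⊥-elim)
open import Function using (_∘_)
open import Relation.Nullary using (¬_; yes; no)
open import Relation.Nullary.Decidable using (toWitness)
open import Relation.Binary.PropositionalEquality

-- Evaluation of polynomials

eval-⊕ : ∀ p q x → eval (p ⊕ q) x ≡ eval p x ℤ.+ eval q x
eval-⊕ []      q       x = sym (ℤ.+-identityˡ _)
eval-⊕ (a ∷ p) []      x = sym (ℤ.+-identityʳ _)
eval-⊕ (a ∷ p) (b ∷ q) x = trans (cong (λ e → a ℤ.+ b ℤ.+ x ℤ.* e) (eval-⊕ p q x)) (interchange a b x _ _)
  where
  interchange : ∀ a b x e f → a ℤ.+ b ℤ.+ x ℤ.* (e ℤ.+ f) ≡ (a ℤ.+ x ℤ.* e) ℤ.+ (b ℤ.+ x ℤ.* f)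
  interchange = ℤ-Solver.solve-∀

eval-scale : ∀ c p x → eval (scale c p) x ≡ c ℤ.* eval p x
eval-scale c []      x = sym (ℤ.*-zeroʳ c)
eval-scale c (a ∷ p) x = trans (cong (λ e → c ℤ.* a ℤ.+ x ℤ.* e) (eval-scale c p x)) (distrib c a x _)
  where
  distrib : ∀ c a x e → c ℤ.* a ℤ.+ x ℤ.* (c ℤ.* e) ≡ c ℤ.* (a ℤ.+ x ℤ.* e)
  distrib = ℤ-Solver.solve-∀

eval-⊗ : ∀ p q x → eval (p ⊗ q) x ≡ eval p x ℤ.* eval q x
eval-⊗ []      q x = refl
eval-⊗ (a ∷ p) q x = begin
  eval (scale a q ⊕ (0ℤ ∷ (p ⊗ q))) x                       ≡⟨ eval-⊕ (scale a q) (0ℤ ∷ (p ⊗ q)) x ⟩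
  eval (scale a q) x ℤ.+ (0ℤ ℤ.+ x ℤ.* eval (p ⊗ q) x)      ≡⟨ cong₂ (λ u v → u ℤ.+ (0ℤ ℤ.+ x ℤ.* v))
                                                                   (eval-scale a q x) (eval-⊗ p q x) ⟩
  a ℤ.* eval q x ℤ.+ (0ℤ ℤ.+ x ℤ.* (eval p x ℤ.* eval q x)) ≡⟨ distrib a (eval p x) x (eval q x) ⟩
  (a ℤ.+ x ℤ.* eval p x) ℤ.* eval q x                       ∎
  where
  open ≡-Reasoning
  distrib : ∀ a e x f → a ℤ.* f ℤ.+ (0ℤ ℤ.+ x ℤ.* (e ℤ.* f)) ≡ (a ℤ.+ x ℤ.* e) ℤ.* f
  distrib = ℤ-Solver.solve-∀

eval-neg : ∀ p x → eval (neg p) x ≡ ℤ.- eval p x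
eval-neg p x = trans (eval-scale (ℤ.- 1ℤ) p x) (ℤ.-1*i≡-i (eval p x))

eval-const : ∀ c x → eval (const c) x ≡ c
eval-const c x = trans (cong (λ e → c ℤ.+ e) (ℤ.*-zeroʳ x)) (ℤ.+-identityʳ c)

IsZero⇒eval≡0 : ∀ {p} → IsZero p → ∀ x → eval p x ≡ 0ℤ
IsZero⇒eval≡0 nil      x = refl
IsZero⇒eval≡0 (cons z) x = trans (cong (λ e → 0ℤ ℤ.+ x ℤ.* e) (IsZero⇒eval≡0 z x)) (cong (λ e → 0ℤ ℤ.+ e) (ℤ.*-zeroʳ x))

IsZero⇒eval-∷ : ∀ {q} a → IsZero q → ∀ x → eval (a ∷ q) x ≡ a
IsZero⇒eval-∷ a zq x = trans (cong (λ e → a ℤ.+ x ℤ.* e) (IsZero⇒eval≡0 zq x)) (eval-const a x)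

IsConstant⇒eval≡ : ∀ p → IsConstant p → ∀ x y → eval p x ≡ eval p y
IsConstant⇒eval≡ []      _  x y = refl
IsConstant⇒eval≡ (a ∷ q) zq x y = trans (IsZero⇒eval-∷ a zq x) (sym (IsZero⇒eval-∷ a zq y))

≈ₚ⇒eval≡ : ∀ {p q} → p ≈ₚ q → ∀ x → eval p x ≡ eval q x
≈ₚ⇒eval≡ {p} {q} p≈q x = ℤ.i-j≡0⇒i≡j (eval p x) (eval q x) (begin
  eval p x ℤ.+ ℤ.- eval q x   ≡⟨ cong (λ e → eval p x ℤ.+ e) (eval-neg q x) ⟨
  eval p x ℤ.+ eval (neg q) x ≡⟨ eval-⊕ p (neg q) x ⟨
  eval (p ⊕ neg q) x          ≡⟨ IsZero⇒eval≡0 p≈q x ⟩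
  0ℤ                          ∎)
  where open ≡-Reasoning

eval-translate : ∀ p x y → ∃ λ q → eval p (x ℤ.+ y) ≡ eval p x ℤ.+ y ℤ.* q
eval-translate []      x y = 0ℤ , cong (λ e → 0ℤ ℤ.+ e) (sym (ℤ.*-zeroʳ y))
eval-translate (a ∷ p) x y with eval-translate p x y
... | q , eq = x ℤ.* q ℤ.+ eval p x ℤ.+ y ℤ.* q , trans (cong (λ e → a ℤ.+ (x ℤ.+ y) ℤ.* e) eq) (expand a x y (eval p x) q)
  where
  expand : ∀ a x y e q →
    a ℤ.+ (x ℤ.+ y) ℤ.* (e ℤ.+ y ℤ.* q) ≡ (a ℤ.+ x ℤ.* e) ℤ.+ y ℤ.* (x ℤ.* q ℤ.+ e ℤ.+ y ℤ.* q)
  expand = ℤ-Solver.solve-∀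

onSurface-eval : (C : A1Curve) → ∀ x →
  OnSurface (eval (A1Curve.tp C) x) (eval (A1Curve.up C) x) (eval (A1Curve.zp C) x)
onSurface-eval C x = begin
  T ℤ.* T ℤ.+ ℤ.- (disc Z ℤ.* (U ℤ.* U))              ≡⟨ cong₂ (λ a b → a ℤ.+ ℤ.- (b ℤ.* (U ℤ.* U))) (eval-⊗ tp tp x) eval-z²+3 ⟨
  eval (tp ⊗ tp) x ℤ.+ ℤ.- (eval z²+3 x ℤ.* (U ℤ.* U)) ≡⟨ cong (λ e → eval (tp ⊗ tp) x ℤ.+ ℤ.- e) eval-[z²+3]u² ⟨
  eval (tp ⊗ tp) x ℤ.+ ℤ.- eval (z²+3 ⊗ (up ⊗ up)) x   ≡⟨ cong (λ e → eval (tp ⊗ tp) x ℤ.+ e) (eval-neg (z²+3 ⊗ (up ⊗ up)) x) ⟨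
  eval (tp ⊗ tp) x ℤ.+ eval (neg (z²+3 ⊗ (up ⊗ up))) x ≡⟨ eval-⊕ (tp ⊗ tp) _ x ⟨
  eval ((tp ⊗ tp) ⊕ neg (z²+3 ⊗ (up ⊗ up))) x          ≡⟨ ≈ₚ⇒eval≡ onSurf x ⟩
  eval (const 1ℤ) x                                   ≡⟨ eval-const 1ℤ x ⟩
  1ℤ                                                  ∎
  where
  open A1Curve C
  open ≡-Reasoning
  T U Z : ℤ
  T = eval tp x
  U = eval up x
  Z = eval zp x
  z²+3 : Poly
  z²+3 = (zp ⊗ zp) ⊕ const (1ℤ ℤ.+ 1ℤ ℤ.+ 1ℤ)
  eval-z²+3 : eval z²+3 x ≡ disc Z
  eval-z²+3 = trans (eval-⊕ (zp ⊗ zp) _ x) (cong₂ ℤ._+_ (eval-⊗ zp zp x) (eval-const _ x))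
  eval-[z²+3]u² : eval (z²+3 ⊗ (up ⊗ up)) x ≡ eval z²+3 x ℤ.* (U ℤ.* U)
  eval-[z²+3]u² = trans (eval-⊗ z²+3 (up ⊗ up) x) (cong (eval z²+3 x ℤ.*_) (eval-⊗ up up x))

-- Asymptotics of polynomial values

Eventually : (ℕ → Set) → Set
Eventually P = ∃ λ B → ∀ X → B ≤ X → P X

module _ {P Q : ℕ → Set} where

  eventually-× : Eventually P → Eventually Q → Eventually (λ X → P X × Q X)
  eventually-× (B , p) (C , q) =
    B ⊔ C , λ X h → p X (≤-trans (m≤m⊔n B C) h) , q X (≤-trans (m≤n⊔m B C) h)

  eventually-map : (∀ {X} → P X → Q X) → Eventually P → Eventually Q
  eventually-map f (B , p) = B , λ X h → f (p X h)

eventually-> : ∀ C → Eventually (C <_)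
eventually-> C = suc C , λ X h → h

eventually-≥1 : Eventually (1 ≤_)
eventually-≥1 = eventually-> 0

¬eventually-≤ : ∀ C → ¬ Eventually (_≤ C)
¬eventually-≤ C (B , p) = <⇒≱ (s≤s (m≤n⊔m B C)) (p (suc (B ⊔ C)) (m≤n⇒m≤1+n (m≤m⊔n B C)))

X^d≥1 : ∀ {X} d → 1 ≤ X → 1 ≤ X ^ d
X^d≥1 {X} d X≥1 = ≤-trans (≤-reflexive (sym (^-zeroˡ d))) (^-monoˡ-≤ d X≥1)

X≤X^suc : ∀ {X} d → 1 ≤ X → X ≤ X ^ suc d
X≤X^suc {X} d X≥1 = m≤m*n X (X ^ d) {{>-nonZero (X^d≥1 d X≥1)}}

*-cancelʳ-≤′ : ∀ m n {o} → 1 ≤ o → m * o ≤ n * o → m ≤ n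
*-cancelʳ-≤′ m n {o} o≥1 = *-cancelʳ-≤ m n o {{>-nonZero o≥1}}

remainder : (ℕ → ℤ) → ℤ → ℕ → ℕ → ℤ
remainder f c d X = f X ℤ.- c ℤ.* + (X ^ d)

-- f X = c X^d + O(X^(d-1)) for X ≥ 1
record Asymptotic (f : ℕ → ℤ) (c : ℤ) (d : ℕ) : Set where
  field
    slack       : ℕ
    remainder-bound : ∀ X → 1 ≤ X → ∣ remainder f c d X ∣ * X ≤ slack * X ^ d

  bound : ℕ
  bound = ∣ c ∣ + slack

  upper : Eventually (λ X → ∣ f X ∣ ≤ bound * X ^ d)
  upper = 1 , λ X X≥1 → *-cancelʳ-≤′ _ _ X≥1 (begin
    ∣ f X ∣ * X                                       ≡⟨ cong (λ e → ∣ e ∣ * X) (split (f X) (c ℤ.* + (X ^ d))) ⟩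
    ∣ c ℤ.* + (X ^ d) ℤ.+ remainder f c d X ∣ * X     ≤⟨ *-monoˡ-≤ X (ℤ.∣i+j∣≤∣i∣+∣j∣ (c ℤ.* + (X ^ d)) _) ⟩
    (∣ c ℤ.* + (X ^ d) ∣ + ∣ remainder f c d X ∣) * X ≡⟨ cong (λ e → (e + ∣ remainder f c d X ∣) * X) (ℤ.abs-* c (+ (X ^ d))) ⟩
    (∣ c ∣ * X ^ d + ∣ remainder f c d X ∣) * X       ≡⟨ *-distribʳ-+ X (∣ c ∣ * X ^ d) _ ⟩
    ∣ c ∣ * X ^ d * X + ∣ remainder f c d X ∣ * X     ≤⟨ +-monoʳ-≤ (∣ c ∣ * X ^ d * X) (remainder-bound X X≥1) ⟩
    ∣ c ∣ * X ^ d * X + slack * X ^ d                 ≤⟨ +-monoʳ-≤ (∣ c ∣ * X ^ d * X) (m≤m*n _ X {{>-nonZero X≥1}}) ⟩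
    ∣ c ∣ * X ^ d * X + slack * X ^ d * X             ≡⟨ *-distribʳ-+ X (∣ c ∣ * X ^ d) _ ⟨
    (∣ c ∣ * X ^ d + slack * X ^ d) * X               ≡⟨ cong (_* X) (*-distribʳ-+ (X ^ d) ∣ c ∣ slack) ⟨
    bound * X ^ d * X                                 ∎)
    where
    open ≤-Reasoning
    split : ∀ e y → e ≡ y ℤ.+ (e ℤ.- y)
    split = ℤ-Solver.solve-∀

  -- for X > 2 · slack the remainder is at most half the leading term
  lower : 1 ≤ ∣ c ∣ → Eventually (λ X → X ^ d ≤ 2 * ∣ f X ∣)
  lower c≢0 = suc (2 * slack) , λ X B≤X → *-cancelʳ-≤′ _ _ (X≥1 B≤X) (+-cancelʳ-≤ (X ^ d * X) _ _ (begin
    X ^ d * X + X ^ d * X                         ≡⟨ double (X ^ d * X) ⟨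
    2 * (X ^ d * X)                               ≤⟨ *-monoʳ-≤ 2 (*-monoˡ-≤ X (leading≤ X)) ⟩
    2 * ((∣ f X ∣ + ∣ remainder f c d X ∣) * X)   ≡⟨ cong (2 *_) (*-distribʳ-+ X ∣ f X ∣ _) ⟩
    2 * (∣ f X ∣ * X + ∣ remainder f c d X ∣ * X) ≤⟨ *-monoʳ-≤ 2 (+-monoʳ-≤ (∣ f X ∣ * X) (remainder-bound X (X≥1 B≤X))) ⟩
    2 * (∣ f X ∣ * X + slack * X ^ d)             ≡⟨ rearrange ∣ f X ∣ X slack (X ^ d) ⟩
    2 * ∣ f X ∣ * X + X ^ d * (2 * slack)         ≤⟨ +-monoʳ-≤ (2 * ∣ f X ∣ * X) (*-monoʳ-≤ (X ^ d) (≤-trans (n≤1+n _) B≤X)) ⟩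
    2 * ∣ f X ∣ * X + X ^ d * X                   ∎))
    where
    open ≤-Reasoning
    X≥1 : ∀ {X} → suc (2 * slack) ≤ X → 1 ≤ X
    X≥1 = ≤-trans (s≤s z≤n)
    double : ∀ m → 2 * m ≡ m + m
    double = solve-∀
    rearrange : ∀ a x s p → 2 * (a * x + s * p) ≡ 2 * a * x + p * (2 * s)
    rearrange = solve-∀
    recover : ∀ e y → y ≡ e ℤ.- (e ℤ.- y)
    recover = ℤ-Solver.solve-∀
    leading≤ : ∀ X → X ^ d ≤ ∣ f X ∣ + ∣ remainder f c d X ∣
    leading≤ X = begin
      X ^ d                           ≤⟨ m≤n*m (X ^ d) ∣ c ∣ {{>-nonZero c≢0}} ⟩
      ∣ c ∣ * X ^ d                   ≡⟨ ℤ.abs-* c (+ (X ^ d)) ⟨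
      ∣ c ℤ.* + (X ^ d) ∣             ≡⟨ cong ∣_∣ (recover (f X) (c ℤ.* + (X ^ d))) ⟩
      ∣ f X ℤ.- remainder f c d X ∣   ≤⟨ ℤ.∣i-j∣≤∣i∣+∣j∣ (f X) (remainder f c d X) ⟩
      ∣ f X ∣ + ∣ remainder f c d X ∣ ∎

degree-mono : ∀ {d e} C → Eventually (λ X → X ^ d ≤ C * X ^ e) → d ≤ e
degree-mono {d} {e} C ev with d ≤? e
... | yes d≤e = d≤e
... | no  d≰e = ⊥-elim (¬eventually-≤ C (eventually-map X≤C (eventually-× ev eventually-≥1)))
  where
  X≤C : ∀ {X} → X ^ d ≤ C * X ^ e × 1 ≤ X → X ≤ C
  X≤C {X} (bound , X≥1) = *-cancelʳ-≤′ X C (X^d≥1 e X≥1)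
    (≤-trans (^-monoʳ-≤ X {{>-nonZero X≥1}} (≰⇒> d≰e)) bound)

open Asymptotic using (slack; remainder-bound)

asymptotic-cong : ∀ {f g c d} → (∀ X → f X ≡ g X) → Asymptotic f c d → Asymptotic g c d
asymptotic-cong {c = c} {d} f≗g af = record
  { slack = slack af
  ; remainder-bound = λ X X≥1 →
      subst (λ e → ∣ e ℤ.- c ℤ.* + (X ^ d) ∣ * X ≤ slack af * X ^ d) (f≗g X) (remainder-bound af X X≥1)
  }

asymptotic-const : ∀ a → Asymptotic (λ _ → a) a 0
asymptotic-const a = record
  { slack = 0
  ; remainder-bound = λ X _ → ≤-reflexive (cong (λ e → ∣ e ∣ * X) (a-a*1≡0 a))
  }
  where
  a-a*1≡0 : ∀ a → a ℤ.- a ℤ.* + 1 ≡ 0ℤ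
  a-a*1≡0 = ℤ-Solver.solve-∀

asymptotic-horner : ∀ {f c d} a → Asymptotic f c d → Asymptotic (λ X → a ℤ.+ + X ℤ.* f X) c (suc d)
asymptotic-horner {f} {c} {d} a af = record
  { slack = ∣ a ∣ + slack af
  ; remainder-bound = bound′
  }
  where
  bound′ : ∀ X → 1 ≤ X → ∣ remainder (λ X → a ℤ.+ + X ℤ.* f X) c (suc d) X ∣ * X ≤ (∣ a ∣ + slack af) * X ^ suc d
  bound′ X X≥1 = begin
    ∣ a ℤ.+ + X ℤ.* f X ℤ.- c ℤ.* + (X * P) ∣ * X ≡⟨ cong (λ e → ∣ e ∣ * X) shifted ⟩
    ∣ a ℤ.+ + X ℤ.* rem ∣ * X                     ≤⟨ *-monoˡ-≤ X (ℤ.∣i+j∣≤∣i∣+∣j∣ a (+ X ℤ.* rem)) ⟩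
    (∣ a ∣ + (∣ + X ℤ.* rem ∣)) * X               ≡⟨ cong (λ e → (∣ a ∣ + e) * X) (ℤ.abs-* (+ X) rem) ⟩
    (∣ a ∣ + X * (∣ rem ∣)) * X                   ≡⟨ rearrange (∣ a ∣) X (∣ rem ∣) ⟩
    ∣ a ∣ * X + X * (∣ rem ∣ * X)                 ≤⟨ +-mono-≤ (*-monoʳ-≤ ∣ a ∣ X≤X*P) (*-monoʳ-≤ X (remainder-bound af X X≥1)) ⟩
    ∣ a ∣ * (X * P) + X * (slack af * P)          ≡⟨ collect (∣ a ∣) (slack af) X P ⟩
    (∣ a ∣ + slack af) * (X * P)                  ∎
    where
    open ≤-Reasoning
    P : ℕ
    P = X ^ d
    rem : ℤ
    rem = remainder f c d X
    X≤X*P : X ≤ X * P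
    X≤X*P = X≤X^suc d X≥1
    shift : ∀ a x f c p → a ℤ.+ x ℤ.* f ℤ.- c ℤ.* (x ℤ.* p) ≡ a ℤ.+ x ℤ.* (f ℤ.- c ℤ.* p)
    shift = ℤ-Solver.solve-∀
    shifted : a ℤ.+ + X ℤ.* f X ℤ.- c ℤ.* + (X * P) ≡ a ℤ.+ + X ℤ.* rem
    shifted = trans (cong (λ e → a ℤ.+ + X ℤ.* f X ℤ.- c ℤ.* e) (ℤ.pos-* X P)) (shift a (+ X) (f X) c (+ P))
    rearrange : ∀ a x e → (a + x * e) * x ≡ a * x + x * (e * x)
    rearrange = solve-∀
    collect : ∀ a s x p → a * (x * p) + x * (s * p) ≡ (a + s) * (x * p)
    collect = solve-∀

asymptotic-+ : ∀ {f g c c′ d} → Asymptotic f c d → Asymptotic g c′ d →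
  Asymptotic (λ X → f X ℤ.+ g X) (c ℤ.+ c′) d
asymptotic-+ {f} {g} {c} {c′} {d} af ag = record
  { slack = slack af + slack ag
  ; remainder-bound = λ X X≥1 → begin
      ∣ f X ℤ.+ g X ℤ.- (c ℤ.+ c′) ℤ.* + (X ^ d) ∣ * X
        ≡⟨ cong (λ e → ∣ e ∣ * X) (split (f X) (g X) c c′ (+ (X ^ d))) ⟩
      ∣ remainder f c d X ℤ.+ remainder g c′ d X ∣ * X
        ≤⟨ *-monoˡ-≤ X (ℤ.∣i+j∣≤∣i∣+∣j∣ (remainder f c d X) _) ⟩
      (∣ remainder f c d X ∣ + ∣ remainder g c′ d X ∣) * X
        ≡⟨ *-distribʳ-+ X (∣ remainder f c d X ∣) _ ⟩
      ∣ remainder f c d X ∣ * X + ∣ remainder g c′ d X ∣ * X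
        ≤⟨ +-mono-≤ (remainder-bound af X X≥1) (remainder-bound ag X X≥1) ⟩
      slack af * X ^ d + slack ag * X ^ d
        ≡⟨ *-distribʳ-+ (X ^ d) (slack af) _ ⟨
      (slack af + slack ag) * X ^ d ∎
  }
  where
  open ≤-Reasoning
  split : ∀ f g c c′ p → f ℤ.+ g ℤ.- (c ℤ.+ c′) ℤ.* p ≡ (f ℤ.- c ℤ.* p) ℤ.+ (g ℤ.- c′ ℤ.* p)
  split = ℤ-Solver.solve-∀

asymptotic-scale : ∀ {f c d} k → Asymptotic f c d → Asymptotic (λ X → k ℤ.* f X) (k ℤ.* c) d
asymptotic-scale {f} {c} {d} k af = record
  { slack = ∣ k ∣ * slack af
  ; remainder-bound = λ X X≥1 → begin
      ∣ k ℤ.* f X ℤ.- k ℤ.* c ℤ.* + (X ^ d) ∣ * X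
        ≡⟨ cong (λ e → ∣ e ∣ * X) (factor k (f X) c (+ (X ^ d))) ⟩
      ∣ k ℤ.* remainder f c d X ∣ * X
        ≡⟨ cong (_* X) (ℤ.abs-* k _) ⟩
      ∣ k ∣ * ∣ remainder f c d X ∣ * X
        ≡⟨ *-assoc ∣ k ∣ _ X ⟩
      ∣ k ∣ * (∣ remainder f c d X ∣ * X)
        ≤⟨ *-monoʳ-≤ ∣ k ∣ (remainder-bound af X X≥1) ⟩
      ∣ k ∣ * (slack af * X ^ d)
        ≡⟨ *-assoc ∣ k ∣ (slack af) (X ^ d) ⟨
      ∣ k ∣ * slack af * X ^ d ∎
  }
  where
  open ≤-Reasoning
  factor : ∀ k f c p → k ℤ.* f ℤ.- k ℤ.* c ℤ.* p ≡ k ℤ.* (f ℤ.- c ℤ.* p)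
  factor = ℤ-Solver.solve-∀

asymptotic-* : ∀ {f g c c′ d d′} → Asymptotic f c d → Asymptotic g c′ d′ →
  Asymptotic (λ X → f X ℤ.* g X) (c ℤ.* c′) (d + d′)
asymptotic-* {f} {g} {c} {c′} {d} {d′} af ag = record
  { slack = slack af * Asymptotic.bound ag + ∣ c ∣ * slack ag
  ; remainder-bound = λ X X≥1 → begin
      ∣ f X ℤ.* g X ℤ.- c ℤ.* c′ ℤ.* + (X ^ (d + d′)) ∣ * X
        ≡⟨ cong (λ e → ∣ e ∣ * X) (trans (cong (λ p → f X ℤ.* g X ℤ.- c ℤ.* c′ ℤ.* p) (X^[d+d′] X))
                                         (split (f X) (g X) c c′ (+ (X ^ d)) (+ (X ^ d′)))) ⟩
      ∣ remainder f c d X ℤ.* g X ℤ.+ c ℤ.* + (X ^ d) ℤ.* remainder g c′ d′ X ∣ * X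
        ≤⟨ *-monoˡ-≤ X (ℤ.∣i+j∣≤∣i∣+∣j∣ (remainder f c d X ℤ.* g X) _) ⟩
      (∣ remainder f c d X ℤ.* g X ∣ + ∣ c ℤ.* + (X ^ d) ℤ.* remainder g c′ d′ X ∣) * X
        ≡⟨ cong₂ (λ a b → (a + b) * X) (ℤ.abs-* (remainder f c d X) (g X))
             (trans (ℤ.abs-* (c ℤ.* + (X ^ d)) _) (cong (_* ∣ remainder g c′ d′ X ∣) (ℤ.abs-* c (+ (X ^ d))))) ⟩
      (∣ remainder f c d X ∣ * ∣ g X ∣ + ∣ c ∣ * X ^ d * ∣ remainder g c′ d′ X ∣) * X
        ≡⟨ rearrange (∣ remainder f c d X ∣) (∣ g X ∣) (∣ c ∣) (X ^ d) (∣ remainder g c′ d′ X ∣) X ⟩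
      ∣ remainder f c d X ∣ * X * ∣ g X ∣ + ∣ c ∣ * X ^ d * (∣ remainder g c′ d′ X ∣ * X)
        ≤⟨ +-mono-≤ (*-mono-≤ (remainder-bound af X X≥1) (proj₂ (Asymptotic.upper ag) X X≥1))
                    (*-monoʳ-≤ (∣ c ∣ * X ^ d) (remainder-bound ag X X≥1)) ⟩
      slack af * X ^ d * (Asymptotic.bound ag * X ^ d′) + ∣ c ∣ * X ^ d * (slack ag * X ^ d′)
        ≡⟨ collect (slack af) (Asymptotic.bound ag) (∣ c ∣) (slack ag) (X ^ d) (X ^ d′) ⟩
      (slack af * Asymptotic.bound ag + ∣ c ∣ * slack ag) * (X ^ d * X ^ d′)
        ≡⟨ cong ((slack af * Asymptotic.bound ag + ∣ c ∣ * slack ag) *_) (^-distribˡ-+-* X d d′) ⟨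
      (slack af * Asymptotic.bound ag + ∣ c ∣ * slack ag) * X ^ (d + d′) ∎
  }
  where
  open ≤-Reasoning
  X^[d+d′] : ∀ X → + (X ^ (d + d′)) ≡ + (X ^ d) ℤ.* + (X ^ d′)
  X^[d+d′] X = trans (cong +_ (^-distribˡ-+-* X d d′)) (ℤ.pos-* (X ^ d) (X ^ d′))
  split : ∀ f g c c′ p p′ → f ℤ.* g ℤ.- c ℤ.* c′ ℤ.* (p ℤ.* p′) ≡ (f ℤ.- c ℤ.* p) ℤ.* g ℤ.+ c ℤ.* p ℤ.* (g ℤ.- c′ ℤ.* p′)
  split = ℤ-Solver.solve-∀
  rearrange : ∀ e g c p e′ x → (e * g + c * p * e′) * x ≡ e * x * g + c * p * (e′ * x)
  rearrange = solve-∀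
  collect : ∀ s b c s′ p p′ → s * p * (b * p′) + c * p * (s′ * p′) ≡ (s * b + c * s′) * (p * p′)
  collect = solve-∀

asymptotic-constant⇒coeff≡0 : ∀ {k c d} → Asymptotic (λ _ → k) c (suc d) → c ≡ 0ℤ
asymptotic-constant⇒coeff≡0 {k} {c} {d} ak with ∣ c ∣ in ∣c∣≡
... | zero  = ℤ.∣i∣≡0⇒i≡0 ∣c∣≡
... | suc _ = ⊥-elim (¬eventually-≤ (2 * ∣ k ∣)
  (eventually-map (λ (X^d≤ , X≥1) → ≤-trans (X≤X^suc d X≥1) X^d≤)
                  (eventually-× (Asymptotic.lower ak (subst (1 ≤_) (sym ∣c∣≡) (s≤s z≤n))) eventually-≥1)))

pell-leading-coefficients : ∀ {f g a b d} D → (∀ X → f X ℤ.* f X ℤ.+ ℤ.- (D ℤ.* (g X ℤ.* g X)) ≡ 1ℤ) →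
  Asymptotic f a (suc d) → Asymptotic g b (suc d) → a ℤ.* a ≡ D ℤ.* (b ℤ.* b)
pell-leading-coefficients {f} {g} {a} {b} D pell af ag =
  trans (move (a ℤ.* a) D (b ℤ.* b)) (trans (cong (ℤ._+ D ℤ.* (b ℤ.* b)) leading≡0) (ℤ.+-identityˡ _))
  where
  pell′ : ∀ X → f X ℤ.* f X ℤ.+ ℤ.- D ℤ.* (g X ℤ.* g X) ≡ 1ℤ
  pell′ X = trans (cong (λ e → f X ℤ.* f X ℤ.+ e) (sym (ℤ.neg-distribˡ-* D _))) (pell X)
  leading≡0 : a ℤ.* a ℤ.+ ℤ.- D ℤ.* (b ℤ.* b) ≡ 0ℤ
  leading≡0 = asymptotic-constant⇒coeff≡0 (asymptotic-cong pell′
    (asymptotic-+ (asymptotic-* af af) (asymptotic-scale (ℤ.- D) (asymptotic-* ag ag))))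
  move : ∀ x d y → x ≡ x ℤ.+ ℤ.- d ℤ.* y ℤ.+ d ℤ.* y
  move = ℤ-Solver.solve-∀

record LeadingTerm (p : Poly) : Set where
  field
    degree      : ℕ
    coeff       : ℤ
    coeff≢0     : 1 ≤ ∣ coeff ∣
    asymptotic  : Asymptotic (λ X → eval p (+ X)) coeff degree
    degree≡0⇒IsConstant : degree ≡ 0 → IsConstant p

  open Asymptotic asymptotic public using (bound; upper)

  lower : Eventually (λ X → X ^ degree ≤ 2 * ∣ eval p (+ X) ∣)
  lower = Asymptotic.lower asymptotic coeff≢0

leadingTerm : ∀ p → IsZero p ⊎ LeadingTerm p
leadingTerm [] = inj₁ nil
leadingTerm (a ∷ q) with leadingTerm q
... | inj₂ lq = inj₂ record
  { degree = suc degree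
  ; coeff = coeff
  ; coeff≢0 = coeff≢0
  ; asymptotic = asymptotic-horner a asymptotic
  ; degree≡0⇒IsConstant = λ ()
  }
  where open LeadingTerm lq
... | inj₁ zq with a ℤ.≟ 0ℤ
...   | yes refl = inj₁ (cons zq)
...   | no  a≢0  = inj₂ record
  { degree = 0
  ; coeff = a
  ; coeff≢0 = n≢0⇒n>0 (a≢0 ∘ ℤ.∣i∣≡0⇒i≡0)
  ; asymptotic = asymptotic-cong (λ X → sym (IsZero⇒eval-∷ a zq (+ X))) (asymptotic-const a)
  ; degree≡0⇒IsConstant = λ _ → zq
  }

GrowsLike : (ℕ → ℕ) → ℕ → Set
GrowsLike f d = ∃ λ L → Eventually (λ X → X ^ d ≤ 2 * f X × f X ≤ L * X ^ d)

growsLike : ∀ {p} (lp : LeadingTerm p) → GrowsLike (λ X → ∣ eval p (+ X) ∣) (LeadingTerm.degree lp)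
growsLike lp = LeadingTerm.bound lp , eventually-× (LeadingTerm.lower lp) (LeadingTerm.upper lp)

1≤2*m⇒1≤m : ∀ {m} → 1 ≤ 2 * m → 1 ≤ m
1≤2*m⇒1≤m {suc m} _ = s≤s z≤n

growsLike⇒≥1 : ∀ {f d} → GrowsLike f d → Eventually (λ X → 1 ≤ f X)
growsLike⇒≥1 {d = d} (_ , ev) =
  eventually-map (λ ((X^d≤ , _) , X≥1) → 1≤2*m⇒1≤m (≤-trans (X^d≥1 d X≥1) X^d≤)) (eventually-× ev eventually-≥1)

-- Arithmetic in ℤ[√D]

m*m≤n*n⇒m≤n : ∀ {m n} → m * m ≤ n * n → m ≤ n
m*m≤n*n⇒m≤n {m} {n} m²≤n² with m ≤? n
... | yes m≤n = m≤n
... | no  m≰n = let n<m = ≰⇒> m≰n in ⊥-elim (<⇒≱ (*-mono-< n<m n<m) m²≤n²)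

m*n*[m*n]≡m*m*[n*n] : ∀ m n → m * n * (m * n) ≡ m * m * (n * n)
m*n*[m*n]≡m*m*[n*n] = solve-∀

∣i^n∣≡∣i∣^n : ∀ i n → ∣ i ℤ.^ n ∣ ≡ ∣ i ∣ ^ n
∣i^n∣≡∣i∣^n i zero    = refl
∣i^n∣≡∣i∣^n i (suc n) = trans (ℤ.abs-* i (i ℤ.^ n)) (cong (∣ i ∣ *_) (∣i^n∣≡∣i∣^n i n))

abs-square-multiple : ∀ a b {s} → + a ℤ.* + a ≡ s ℤ.* (+ b ℤ.* + b) → a * a ≡ ∣ s ∣ * (b * b)
abs-square-multiple a b {s} eq = begin
  a * a                   ≡⟨ ℤ.abs-* (+ a) (+ a) ⟨
  ∣ + a ℤ.* + a ∣         ≡⟨ cong ∣_∣ eq ⟩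
  ∣ s ℤ.* (+ b ℤ.* + b) ∣ ≡⟨ ℤ.abs-* s _ ⟩
  ∣ s ∣ * ∣ + b ℤ.* + b ∣ ≡⟨ cong (∣ s ∣ *_) (ℤ.abs-* (+ b) (+ b)) ⟩
  ∣ s ∣ * (b * b)         ∎
  where open ≡-Reasoning

prime-3 : Prime 3
prime-3 = toWitness {a? = prime? 3} _

prime∣m*m⇒∣m : ∀ {p m} → Prime p → p ℕ.∣ m * m → p ℕ.∣ m
prime∣m*m⇒∣m {m = m} prime-p p∣m² with euclidsLemma m m prime-p p∣m²
... | inj₁ p∣m = p∣m
... | inj₂ p∣m = p∣m

prime∤-* : ∀ {p m n} → Prime p → ¬ p ℕ.∣ m → ¬ p ℕ.∣ n → ¬ p ℕ.∣ m * n
prime∤-* {m = m} {n} prime-p p∤m p∤n p∣mn with euclidsLemma m n prime-p p∣mn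
... | inj₁ p∣m = p∤m p∣m
... | inj₂ p∣n = p∤n p∣n

-- A pair (a , b) stands for a + b√D.
module Quadratic (D : ℕ) where

  _·_ : ℕ × ℕ → ℕ × ℕ → ℕ × ℕ
  (a , b) · (c , d) = a * c + D * (b * d) , a * d + b * c

  pow : ℕ × ℕ → ℕ → ℕ × ℕ
  pow x zero    = 1 , 0
  pow x (suc j) = x · pow x j

  norm : ℕ × ℕ → ℤ
  norm (a , b) = + a ℤ.* + a ℤ.- + D ℤ.* (+ b ℤ.* + b)

  record IsPell (x : ℕ × ℕ) : Set where
    constructor isPell
    field equation : proj₁ x * proj₁ x ≡ 1 + D * (proj₂ x * proj₂ x)

  norm-· : ∀ x y → norm (x · y) ≡ norm x ℤ.* norm y
  norm-· (a , b) (c , d) = begin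
    norm (a * c + D * (b * d) , a * d + b * c) ≡⟨ cong₂ (λ r i → r ℤ.* r ℤ.- + D ℤ.* (i ℤ.* i)) re-cast im-cast ⟩
    _                                          ≡⟨ brahmagupta (+ a) (+ b) (+ c) (+ d) (+ D) ⟩
    norm (a , b) ℤ.* norm (c , d)              ∎
    where
    open ≡-Reasoning
    re-cast : + (a * c + D * (b * d)) ≡ + a ℤ.* + c ℤ.+ + D ℤ.* (+ b ℤ.* + d)
    re-cast = trans (ℤ.pos-+ (a * c) _) (cong₂ ℤ._+_ (ℤ.pos-* a c)
                (trans (ℤ.pos-* D (b * d)) (cong (+ D ℤ.*_) (ℤ.pos-* b d))))
    im-cast : + (a * d + b * c) ≡ + a ℤ.* + d ℤ.+ + b ℤ.* + c
    im-cast = trans (ℤ.pos-+ (a * d) _) (cong₂ ℤ._+_ (ℤ.pos-* a d) (ℤ.pos-* b c))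
    brahmagupta : ∀ a b c d D →
      (a ℤ.* c ℤ.+ D ℤ.* (b ℤ.* d)) ℤ.* (a ℤ.* c ℤ.+ D ℤ.* (b ℤ.* d))
        ℤ.- D ℤ.* ((a ℤ.* d ℤ.+ b ℤ.* c) ℤ.* (a ℤ.* d ℤ.+ b ℤ.* c))
      ≡ (a ℤ.* a ℤ.- D ℤ.* (b ℤ.* b)) ℤ.* (c ℤ.* c ℤ.- D ℤ.* (d ℤ.* d))
    brahmagupta = ℤ-Solver.solve-∀

  norm-pow : ∀ x j → norm (pow x j) ≡ norm x ℤ.^ j
  norm-pow x zero    = cong (λ e → 1ℤ ℤ.- e) (ℤ.*-zeroʳ (+ D))
  norm-pow x (suc j) = trans (norm-· x (pow x j)) (cong (norm x ℤ.*_) (norm-pow x j))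

  norm-cast : ∀ a b → norm (a , b) ≡ + (a * a) ℤ.- + (D * (b * b))
  norm-cast a b = sym (cong₂ ℤ._-_ (ℤ.pos-* a a) (trans (ℤ.pos-* D _) (cong (+ D ℤ.*_) (ℤ.pos-* b b))))

  IsPell⇒norm≡1 : ∀ {a b} → IsPell (a , b) → norm (a , b) ≡ 1ℤ
  IsPell⇒norm≡1 {a} {b} (isPell pell) = begin
    norm (a , b)                               ≡⟨ norm-cast a b ⟩
    + (a * a) ℤ.- + (D * (b * b))              ≡⟨ cong (ℤ._- + (D * (b * b))) (trans (cong +_ pell) (ℤ.pos-+ 1 _)) ⟩
    1ℤ ℤ.+ + (D * (b * b)) ℤ.- + (D * (b * b)) ≡⟨ cancel (+ (D * (b * b))) ⟩
    1ℤ                                         ∎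
    where
    open ≡-Reasoning
    cancel : ∀ j → 1ℤ ℤ.+ j ℤ.- j ≡ 1ℤ
    cancel = ℤ-Solver.solve-∀

  norm≡1⇒IsPell : ∀ {a b} → norm (a , b) ≡ 1ℤ → IsPell (a , b)
  norm≡1⇒IsPell {a} {b} norm≡1 = isPell (ℤ.+-injective (begin
    + (a * a)                                         ≡⟨ uncancel (+ (a * a)) (+ (D * (b * b))) ⟩
    + (a * a) ℤ.- + (D * (b * b)) ℤ.+ + (D * (b * b)) ≡⟨ cong (ℤ._+ + (D * (b * b))) (trans (sym (norm-cast a b)) norm≡1) ⟩
    1ℤ ℤ.+ + (D * (b * b))                            ≡⟨ ℤ.pos-+ 1 _ ⟨
    + (1 + D * (b * b))                               ∎))
    where
    open ≡-Reasoning
    uncancel : ∀ i j → i ≡ i ℤ.- j ℤ.+ j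
    uncancel = ℤ-Solver.solve-∀

  IsPell-pow : ∀ {x} → IsPell x → ∀ j → IsPell (pow x j)
  IsPell-pow {x@(_ , _)} pell j = norm≡1⇒IsPell (begin
    norm (pow x j) ≡⟨ norm-pow x j ⟩
    norm x ℤ.^ j   ≡⟨ cong (ℤ._^ j) (IsPell⇒norm≡1 pell) ⟩
    1ℤ ℤ.^ j       ≡⟨ ℤ.^-zeroˡ j ⟩
    1ℤ             ∎)
    where open ≡-Reasoning

  IsPell⇒1≤a : ∀ {a b} → IsPell (a , b) → 1 ≤ a
  IsPell⇒1≤a {zero}  (isPell ())
  IsPell⇒1≤a {suc a} _ = s≤s z≤n

  re-pow-≥ : ∀ x j → proj₁ x ^ j ≤ proj₁ (pow x j)
  re-pow-≥ x       zero    = ≤-refl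
  re-pow-≥ (a , b) (suc j) = ≤-trans (*-monoʳ-≤ a (re-pow-≥ (a , b) j)) (m≤m+n _ _)

  im-pow-suc-≥ : ∀ x j → proj₂ x * proj₁ (pow x j) ≤ proj₂ (pow x (suc j))
  im-pow-suc-≥ (a , b) j = m≤n+m _ _

  -- (a - n b)(c - n d) ≥ 0 and n² ≤ D: the cone a ≥ n b is closed under multiplication
  ·-cone : ∀ {n a b c d} → n * n ≤ D → n * b ≤ a → n * d ≤ c →
    n * proj₂ ((a , b) · (c , d)) ≤ proj₁ ((a , b) · (c , d))
  ·-cone {n} {b = b} {d = d} n²≤D nb≤a nd≤c with m≤n⇒∃[o]m+o≡n nb≤a | m≤n⇒∃[o]m+o≡n nd≤c
  ... | a′ , refl | c′ , refl = begin
    n * ((n * b + a′) * d + b * (n * d + c′))           ≤⟨ m≤m+n _ (a′ * c′) ⟩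
    n * ((n * b + a′) * d + b * (n * d + c′)) + a′ * c′ ≡⟨ expand n b a′ d c′ ⟩
    (n * b + a′) * (n * d + c′) + n * n * (b * d)       ≤⟨ +-monoʳ-≤ _ (*-monoˡ-≤ (b * d) n²≤D) ⟩
    (n * b + a′) * (n * d + c′) + D * (b * d)           ∎
    where
    open ≤-Reasoning
    expand : ∀ n b a′ d c′ → n * ((n * b + a′) * d + b * (n * d + c′)) + a′ * c′
                           ≡ (n * b + a′) * (n * d + c′) + n * n * (b * d)
    expand = solve-∀

  pow-cone : ∀ {n a b} → n * n ≤ D → n * b ≤ a → ∀ j → n * proj₂ (pow (a , b) j) ≤ proj₁ (pow (a , b) j)
  pow-cone {n}         n²≤D nb≤a zero    = ≤-trans (≤-reflexive (*-zeroʳ n)) z≤n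
  pow-cone {n} {a} {b} n²≤D nb≤a (suc j) =
    ·-cone {n} {a} {b} {proj₁ (pow (a , b) j)} n²≤D nb≤a (pow-cone {n} n²≤D nb≤a j)

  IsPell⇒D*b*b≤a*a : ∀ {a b} → IsPell (a , b) → D * (b * b) ≤ a * a
  IsPell⇒D*b*b≤a*a (isPell pell) = ≤-trans (n≤1+n _) (≤-reflexive (sym pell))

  IsPell⇒n*b≤a : ∀ {n a b} → n * n ≤ D → IsPell (a , b) → n * b ≤ a
  IsPell⇒n*b≤a {n} {a} {b} n²≤D pell = m*m≤n*n⇒m≤n (begin
    n * b * (n * b) ≡⟨ m*n*[m*n]≡m*m*[n*n] n b ⟩
    n * n * (b * b) ≤⟨ *-monoˡ-≤ (b * b) n²≤D ⟩
    D * (b * b)     ≤⟨ IsPell⇒D*b*b≤a*a pell ⟩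
    a * a           ∎)
    where open ≤-Reasoning

  IsPell⇒a≤m*b : ∀ {m a b} → 1 + D ≤ m * m → 1 ≤ b → IsPell (a , b) → a ≤ m * b
  IsPell⇒a≤m*b {m} {a} {b} 1+D≤m² b≥1 (isPell pell) = m*m≤n*n⇒m≤n (begin
    a * a               ≡⟨ pell ⟩
    1 + D * (b * b)     ≤⟨ +-monoˡ-≤ _ (*-mono-≤ b≥1 b≥1) ⟩
    b * b + D * (b * b) ≡⟨⟩
    (1 + D) * (b * b)   ≤⟨ *-monoˡ-≤ (b * b) 1+D≤m² ⟩
    m * m * (b * b)     ≡⟨ m*n*[m*n]≡m*m*[n*n] m b ⟨
    m * b * (m * b)     ∎)
    where open ≤-Reasoning

  IsPell⇒D*b*d≤a*c : ∀ {a b c d} → IsPell (a , b) → IsPell (c , d) → D * (b * d) ≤ a * c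
  IsPell⇒D*b*d≤a*c {a} {b} {c} {d} pell₁ pell₂ = m*m≤n*n⇒m≤n (begin
    D * (b * d) * (D * (b * d)) ≡⟨ regroup D b d ⟩
    D * (b * b) * (D * (d * d)) ≤⟨ *-mono-≤ (IsPell⇒D*b*b≤a*a pell₁) (IsPell⇒D*b*b≤a*a pell₂) ⟩
    a * a * (c * c)             ≡⟨ m*n*[m*n]≡m*m*[n*n] a c ⟨
    a * c * (a * c)             ∎)
    where
    open ≤-Reasoning
    regroup : ∀ D b d → D * (b * d) * (D * (b * d)) ≡ D * (b * b) * (D * (d * d))
    regroup = solve-∀

  re-pow-≤ : ∀ {a b} → IsPell (a , b) → ∀ j → proj₁ (pow (a , b) j) ≤ (2 * a) ^ j
  re-pow-≤         pell zero    = ≤-refl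
  re-pow-≤ {a} {b} pell (suc j) = begin
    a * A + D * (b * B) ≤⟨ +-monoʳ-≤ (a * A) (IsPell⇒D*b*d≤a*c pell (IsPell-pow pell j)) ⟩
    a * A + a * A       ≡⟨ double a A ⟩
    2 * a * A           ≤⟨ *-monoʳ-≤ (2 * a) (re-pow-≤ pell j) ⟩
    2 * a * (2 * a) ^ j ∎
    where
    open ≤-Reasoning
    A B : ℕ
    A = proj₁ (pow (a , b) j)
    B = proj₂ (pow (a , b) j)
    double : ∀ a A → a * A + a * A ≡ 2 * a * A
    double = solve-∀

  cross-identity : ∀ {ea eb pa pb s} → norm (ea , eb) ≡ 1ℤ → norm (pa , pb) ≡ s →
    (+ eb ℤ.* + pa ℤ.- + ea ℤ.* + pb) ℤ.* (+ eb ℤ.* + pa ℤ.+ + ea ℤ.* + pb)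
      ≡ s ℤ.* (+ eb ℤ.* + eb) ℤ.- + pb ℤ.* + pb
  cross-identity {ea} {eb} {pa} {pb} {s} normE normP = begin
    (+ eb ℤ.* + pa ℤ.- + ea ℤ.* + pb) ℤ.* (+ eb ℤ.* + pa ℤ.+ + ea ℤ.* + pb)
      ≡⟨ expand (+ ea) (+ eb) (+ pa) (+ pb) (+ D) ⟩
    norm (pa , pb) ℤ.* (+ eb ℤ.* + eb) ℤ.- norm (ea , eb) ℤ.* (+ pb ℤ.* + pb)
      ≡⟨ cong₂ (λ p e → p ℤ.* (+ eb ℤ.* + eb) ℤ.- e ℤ.* (+ pb ℤ.* + pb)) normP normE ⟩
    s ℤ.* (+ eb ℤ.* + eb) ℤ.- 1ℤ ℤ.* (+ pb ℤ.* + pb)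
      ≡⟨ cong (λ e → s ℤ.* (+ eb ℤ.* + eb) ℤ.- e) (ℤ.*-identityˡ _) ⟩
    s ℤ.* (+ eb ℤ.* + eb) ℤ.- + pb ℤ.* + pb ∎
    where
    open ≡-Reasoning
    expand : ∀ ea eb pa pb D →
      (eb ℤ.* pa ℤ.- ea ℤ.* pb) ℤ.* (eb ℤ.* pa ℤ.+ ea ℤ.* pb)
        ≡ (pa ℤ.* pa ℤ.- D ℤ.* (pb ℤ.* pb)) ℤ.* (eb ℤ.* eb) ℤ.- (ea ℤ.* ea ℤ.- D ℤ.* (eb ℤ.* eb)) ℤ.* (pb ℤ.* pb)
    expand = ℤ-Solver.solve-∀

  -- For E = ea + eb√D of norm 1 and P = pa + pb√D, R = eb pa - ea pb is minus the √D-part of P·Ē = P/E.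
  -- Since R · (eb pa + ea pb) = s eb² - pb² and the hypotheses give |s eb² - pb²| < eb pa + ea pb, R = 0.
  quotient-rational : ∀ {ea eb pa pb s} → IsPell (ea , eb) → norm (pa , pb) ≡ s →
    ∣ s ∣ * (eb * eb) < ea * pb → pb * pb ≤ eb * pa → + pb ℤ.* + pb ≡ s ℤ.* (+ eb ℤ.* + eb)
  quotient-rational {ea} {eb} {pa} {pb} {s} pellE normP small₁ small₂ =
    sym (ℤ.i-j≡0⇒i≡j _ _ (trans (sym RS≡) (trans (cong (ℤ._* S) R≡0) (ℤ.*-zeroˡ S))))
    where
    R S : ℤ
    R = + eb ℤ.* + pa ℤ.- + ea ℤ.* + pb
    S = + eb ℤ.* + pa ℤ.+ + ea ℤ.* + pb
    RS≡ : R ℤ.* S ≡ s ℤ.* (+ eb ℤ.* + eb) ℤ.- + pb ℤ.* + pb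
    RS≡ = cross-identity {ea} {eb} {pa} {pb} (IsPell⇒norm≡1 pellE) normP
    ∣S∣≡ : ∣ S ∣ ≡ eb * pa + ea * pb
    ∣S∣≡ = sym (cong ∣_∣ (trans (ℤ.pos-+ (eb * pa) _) (cong₂ ℤ._+_ (ℤ.pos-* eb pa) (ℤ.pos-* ea pb))))
    ∣s*eb²-pb²∣≤ : ∣ s ℤ.* (+ eb ℤ.* + eb) ℤ.- + pb ℤ.* + pb ∣ ≤ ∣ s ∣ * (eb * eb) + pb * pb
    ∣s*eb²-pb²∣≤ = ≤-trans (ℤ.∣i-j∣≤∣i∣+∣j∣ (s ℤ.* (+ eb ℤ.* + eb)) _) (≤-reflexive (cong₂ _+_
      (trans (ℤ.abs-* s _) (cong (∣ s ∣ *_) (ℤ.abs-* (+ eb) (+ eb)))) (ℤ.abs-* (+ pb) (+ pb))))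
    R≡0 : R ≡ 0ℤ
    R≡0 with R ℤ.≟ 0ℤ
    ... | yes R≡0 = R≡0
    ... | no  R≢0 = ⊥-elim (<⇒≱ (+-mono-<-≤ small₁ small₂) (begin
      ea * pb + eb * pa                           ≡⟨ +-comm (ea * pb) (eb * pa) ⟩
      eb * pa + ea * pb                           ≡⟨ ∣S∣≡ ⟨
      ∣ S ∣                                       ≤⟨ m≤n*m ∣ S ∣ ∣ R ∣ {{≢-nonZero (R≢0 ∘ ℤ.∣i∣≡0⇒i≡0)}} ⟩
      ∣ R ∣ * ∣ S ∣                               ≡⟨ ℤ.abs-* R S ⟨
      ∣ R ℤ.* S ∣                                 ≡⟨ cong ∣_∣ RS≡ ⟩
      ∣ s ℤ.* (+ eb ℤ.* + eb) ℤ.- + pb ℤ.* + pb ∣ ≤⟨ ∣s*eb²-pb²∣≤ ⟩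
      ∣ s ∣ * (eb * eb) + pb * pb                 ∎))
      where open ≤-Reasoning

module NormMinusThree (m : ℕ) where

  n : ℕ
  n = suc m

  open Quadratic (n * n + 3)

  β : ℕ × ℕ
  β = n , 1

  norm-β : norm β ≡ ℤ.- + 3
  norm-β = trans (cong (λ d → + n ℤ.* + n ℤ.- d ℤ.* (+ 1 ℤ.* + 1))
                       (trans (ℤ.pos-+ (n * n) 3) (cong (ℤ._+ + 3) (ℤ.pos-* n n))))
                 (difference (+ n))
    where
    difference : ∀ a → a ℤ.* a ℤ.- (a ℤ.* a ℤ.+ + 3) ℤ.* (+ 1 ℤ.* + 1) ≡ ℤ.- + 3
    difference = ℤ-Solver.solve-∀

  ∣norm-β-pow∣ : ∀ j → ∣ norm (pow β j) ∣ ≡ 3 ^ j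
  ∣norm-β-pow∣ j = begin
    ∣ norm (pow β j) ∣  ≡⟨ cong ∣_∣ (norm-pow β j) ⟩
    ∣ norm β ℤ.^ j ∣    ≡⟨ cong (λ e → ∣ e ℤ.^ j ∣) norm-β ⟩
    ∣ (ℤ.- + 3) ℤ.^ j ∣ ≡⟨ ∣i^n∣≡∣i∣^n (ℤ.- + 3) j ⟩
    3 ^ j               ∎
    where open ≡-Reasoning

  β-pow-bound : ∀ j → proj₁ (pow β j) + (n + 1) * proj₂ (pow β j) ≤ (2 * n + 2) ^ j
  β-pow-bound zero    = ≤-reflexive (cong suc (*-zeroʳ (n + 1)))
  β-pow-bound (suc j) = begin
    (n * A + D * (1 * B)) + (n + 1) * (n * B + 1 * A)                         ≤⟨ m≤m+n _ _ ⟩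
    (n * A + D * (1 * B)) + (n + 1) * (n * B + 1 * A) + (A + (3 * m + 2) * B) ≡⟨ expand m A B ⟨
    (2 * n + 2) * (A + (n + 1) * B)                                           ≤⟨ *-monoʳ-≤ (2 * n + 2) (β-pow-bound j) ⟩
    (2 * n + 2) * (2 * n + 2) ^ j                                             ∎
    where
    open ≤-Reasoning
    D A B : ℕ
    D = n * n + 3
    A = proj₁ (pow β j)
    B = proj₂ (pow β j)
    expand : ∀ m A B → (2 * suc m + 2) * (A + (suc m + 1) * B)
      ≡ (suc m * A + (suc m * suc m + 3) * (1 * B)) + (suc m + 1) * (suc m * B + 1 * A) + (A + (3 * m + 2) * B)
    expand = solve-∀

  im-β-pow-suc≤ : ∀ k → proj₂ (pow β (suc k)) ≤ (2 * n + 2) ^ k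
  im-β-pow-suc≤ k = begin
    n * B + 1 * A   ≡⟨ swap n A B ⟩
    A + n * B       ≤⟨ +-monoʳ-≤ A (*-monoˡ-≤ B (m≤m+n n 1)) ⟩
    A + (n + 1) * B ≤⟨ β-pow-bound k ⟩
    (2 * n + 2) ^ k ∎
    where
    open ≤-Reasoning
    A B : ℕ
    A = proj₁ (pow β k)
    B = proj₂ (pow β k)
    swap : ∀ n A B → n * B + 1 * A ≡ A + n * B
    swap = solve-∀

  -- im β^(j+2) = 2n · im β^(j+1) + 3 · im β^j
  3∤im-β-pow-suc : ¬ 3 ℕ.∣ n → ∀ j → ¬ 3 ℕ.∣ proj₂ (pow β (suc j))
  3∤im-β-pow-suc 3∤n zero    3∣im rewrite *-zeroʳ n with ℕ.∣1⇒≡1 3∣im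
  ... | ()
  3∤im-β-pow-suc 3∤n (suc j) 3∣im =
    prime∤-* prime-3 3∤2n (3∤im-β-pow-suc 3∤n j) (ℕ.∣m+n∣m⇒∣n (subst (3 ℕ.∣_) (recurrence n A B) 3∣im) (ℕ.m∣m*n B))
    where
    A B : ℕ
    A = proj₁ (pow β j)
    B = proj₂ (pow β j)
    recurrence : ∀ n A B → n * (n * B + 1 * A) + 1 * (n * A + (n * n + 3) * (1 * B)) ≡ 3 * B + 2 * n * (n * B + 1 * A)
    recurrence = solve-∀
    3∤2n : ¬ 3 ℕ.∣ 2 * n
    3∤2n = prime∤-* prime-3 (λ 3∣2 → <⇒≱ (s≤s (s≤s (s≤s z≤n))) (ℕ.∣⇒≤ 3∣2)) 3∤n

  -- With ε = T + U√D, the growth hypotheses yield the estimates of quotient-rational for E = ε^M, P = β^K.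
  no-close-unit-power : ∀ {T U} k M′ → ¬ 3 ℕ.∣ n → IsPell (T , U) → 1 ≤ U →
    3 ^ suc k * (2 * T) ^ suc M′ < n * n * n ^ k → 3 * (2 * n + 2) ^ k ≤ T ^ suc M′ → ⊥
  no-close-unit-power {T} {U} k M′ 3∤n pellε U≥1 growth₁ growth₂ =
    3∤im-β-pow-suc 3∤n k 3∣Pb
    where
    open ≤-Reasoning
    K M D Ea Eb Pa Pb : ℕ
    K = suc k
    M = suc M′
    D = n * n + 3
    Ea = proj₁ (pow (T , U) M)
    Eb = proj₂ (pow (T , U) M)
    Pa = proj₁ (pow β K)
    Pb = proj₂ (pow β K)
    pellE : IsPell (Ea , Eb)
    pellE = IsPell-pow pellε M
    n²≤D : n * n ≤ D
    n²≤D = m≤m+n (n * n) 3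
    n*Eb≤Ea : n * Eb ≤ Ea
    n*Eb≤Ea = pow-cone {n} n²≤D (IsPell⇒n*b≤a {n} n²≤D pellε) M
    n^k≤Pb : n ^ k ≤ Pb
    n^k≤Pb = ≤-trans (re-pow-≥ β k) (≤-trans (≤-reflexive (sym (*-identityˡ _))) (im-pow-suc-≥ β k))

    3^K*Eb²<Ea*Pb : 3 ^ K * (Eb * Eb) < Ea * Pb
    3^K*Eb²<Ea*Pb = *-cancelˡ-< (n * n) _ _ (begin-strict
      n * n * (3 ^ K * (Eb * Eb)) ≡⟨ regroup n (3 ^ K) Eb ⟩
      3 ^ K * (n * Eb * (n * Eb)) ≤⟨ *-monoʳ-≤ (3 ^ K) (*-mono-≤ n*Eb≤Ea n*Eb≤Ea) ⟩
      3 ^ K * (Ea * Ea)           ≤⟨ *-monoʳ-≤ (3 ^ K) (*-monoˡ-≤ Ea (re-pow-≤ pellε M)) ⟩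
      3 ^ K * ((2 * T) ^ M * Ea)  ≡⟨ *-assoc (3 ^ K) _ Ea ⟨
      3 ^ K * (2 * T) ^ M * Ea    <⟨ *-monoˡ-< Ea {{>-nonZero (IsPell⇒1≤a pellE)}} growth₁ ⟩
      n * n * n ^ k * Ea          ≤⟨ *-monoˡ-≤ Ea (*-monoʳ-≤ (n * n) n^k≤Pb) ⟩
      n * n * Pb * Ea             ≡⟨ regroup′ (n * n) Pb Ea ⟩
      n * n * (Ea * Pb)           ∎)
      where
      regroup : ∀ n t e → n * n * (t * (e * e)) ≡ t * (n * e * (n * e))
      regroup = solve-∀
      regroup′ : ∀ c p e → c * p * e ≡ c * (e * p)
      regroup′ = solve-∀

    T≤[n+2]U : T ≤ (n + 2) * U
    T≤[n+2]U = IsPell⇒a≤m*b {n + 2} (≤-trans (m≤m+n _ (4 * n)) (≤-reflexive (square m))) U≥1 pellε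
      where
      square : ∀ m → 1 + (suc m * suc m + 3) + 4 * suc m ≡ (suc m + 2) * (suc m + 2)
      square = solve-∀

    Pb≤n*Eb : Pb ≤ n * Eb
    Pb≤n*Eb = *-cancelˡ-≤ 3 (begin
      3 * Pb                                 ≤⟨ *-monoʳ-≤ 3 (im-β-pow-suc≤ k) ⟩
      3 * (2 * n + 2) ^ k                    ≤⟨ growth₂ ⟩
      T * T ^ M′                             ≤⟨ *-mono-≤ T≤[n+2]U (re-pow-≥ (T , U) M′) ⟩
      (n + 2) * U * proj₁ (pow (T , U) M′)   ≡⟨ *-assoc (n + 2) U _ ⟩
      (n + 2) * (U * proj₁ (pow (T , U) M′)) ≤⟨ *-monoʳ-≤ (n + 2) (im-pow-suc-≥ (T , U) M′) ⟩
      (n + 2) * Eb                           ≤⟨ *-monoˡ-≤ Eb (≤-trans (m≤m+n (n + 2) (2 * m)) (≤-reflexive (triple m))) ⟩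
      3 * n * Eb                             ≡⟨ *-assoc 3 n Eb ⟩
      3 * (n * Eb)                           ∎)
      where
      triple : ∀ m → suc m + 2 + 2 * m ≡ 3 * suc m
      triple = solve-∀

    Pb²≤Eb*Pa : Pb * Pb ≤ Eb * Pa
    Pb²≤Eb*Pa = begin
      Pb * Pb       ≤⟨ *-monoˡ-≤ Pb Pb≤n*Eb ⟩
      n * Eb * Pb   ≡⟨ regroup n Eb Pb ⟩
      Eb * (n * Pb) ≤⟨ *-monoʳ-≤ Eb (pow-cone {n} n²≤D (≤-reflexive (*-identityʳ n)) K) ⟩
      Eb * Pa       ∎
      where
      regroup : ∀ n e p → n * e * p ≡ e * (n * p)
      regroup = solve-∀

    Pb²≡ : + Pb ℤ.* + Pb ≡ norm (pow β K) ℤ.* (+ Eb ℤ.* + Eb)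
    Pb²≡ = quotient-rational {Ea} {Eb} {Pa} {Pb} pellE refl
      (subst (λ c → c * (Eb * Eb) < Ea * Pb) (sym (∣norm-β-pow∣ K)) 3^K*Eb²<Ea*Pb) Pb²≤Eb*Pa

    Pb²≡3^K*Eb² : Pb * Pb ≡ 3 ^ K * (Eb * Eb)
    Pb²≡3^K*Eb² = trans (abs-square-multiple Pb Eb {norm (pow β K)} Pb²≡) (cong (_* (Eb * Eb)) (∣norm-β-pow∣ K))

    3∣Pb : 3 ℕ.∣ Pb
    3∣Pb = prime∣m*m⇒∣m prime-3
      (subst (3 ℕ.∣_) (sym (trans Pb²≡3^K*Eb² (*-assoc 3 (3 ^ k) _))) (ℕ.m∣m*n (3 ^ k * (Eb * Eb))))

-- Pell equations along a family of integers

^-distribʳ-* : ∀ a b k → (a * b) ^ k ≡ a ^ k * b ^ k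
^-distribʳ-* a b zero    = refl
^-distribʳ-* a b (suc k) = trans (cong (a * b *_) (^-distribʳ-* a b k)) (interchange a b (a ^ k) (b ^ k))
  where
  interchange : ∀ a b x y → a * b * (x * y) ≡ a * x * (b * y)
  interchange = solve-∀

^-comm : ∀ X K M → (X ^ K) ^ M ≡ (X ^ M) ^ K
^-comm X K M = trans (^-*-assoc X K M) (trans (cong (X ^_) (*-comm K M)) (sym (^-*-assoc X M K)))

-- T ≍ X^K and n ≍ X^M, so (2T)^M ≍ X^(KM) is smaller than n^(K+1) ≍ X^(KM+M) by a power of X.
3^K*[2T]^M<n^[K+1] : ∀ {X T n Lt} k M′ → 1 ≤ X → T ≤ Lt * X ^ suc k → X ^ suc M′ ≤ 2 * n →
  2 ^ suc (suc k) * 3 ^ suc k * 2 ^ suc M′ * Lt ^ suc M′ < X →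
  3 ^ suc k * (2 * T) ^ suc M′ < n * n * n ^ k
3^K*[2T]^M<n^[K+1] {X} {T} {n} {Lt} k M′ X≥1 T≤ X^M≤ C<X = *-cancelˡ-< (2 ^ suc K) _ _ (begin-strict
  2 ^ suc K * (3 ^ K * (2 * T) ^ M)                ≡⟨ cong (λ w → 2 ^ suc K * (3 ^ K * w)) (^-distribʳ-* 2 T M) ⟩
  2 ^ suc K * (3 ^ K * (2 ^ M * T ^ M))            ≤⟨ *-monoʳ-≤ (2 ^ suc K) (*-monoʳ-≤ (3 ^ K) (*-monoʳ-≤ (2 ^ M) (^-monoˡ-≤ M T≤))) ⟩
  2 ^ suc K * (3 ^ K * (2 ^ M * (Lt * X ^ K) ^ M)) ≡⟨ cong (λ w → 2 ^ suc K * (3 ^ K * (2 ^ M * w)))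
                                                          (trans (^-distribʳ-* Lt (X ^ K) M) (cong (Lt ^ M *_) (^-comm X K M))) ⟩
  2 ^ suc K * (3 ^ K * (2 ^ M * (Lt ^ M * Y ^ K))) ≡⟨ regroup (2 ^ suc K) (3 ^ K) (2 ^ M) (Lt ^ M) (Y ^ K) ⟩
  2 ^ suc K * 3 ^ K * 2 ^ M * Lt ^ M * Y ^ K       <⟨ *-monoˡ-< (Y ^ K) {{>-nonZero (X^d≥1 K Y≥1)}} (<-≤-trans C<X (X≤X^suc M′ X≥1)) ⟩
  Y * Y ^ K                                        ≤⟨ ^-monoˡ-≤ (suc K) X^M≤ ⟩
  (2 * n) ^ suc K                                  ≡⟨ ^-distribʳ-* 2 n (suc K) ⟩
  2 ^ suc K * (n * (n * n ^ k))                    ≡⟨ cong (2 ^ suc K *_) (*-assoc n n (n ^ k)) ⟨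
  2 ^ suc K * (n * n * n ^ k)                      ∎)
  where
  open ≤-Reasoning
  K M Y : ℕ
  K = suc k
  M = suc M′
  Y = X ^ M
  Y≥1 : 1 ≤ Y
  Y≥1 = X^d≥1 M X≥1
  regroup : ∀ a b c d e → a * (b * (c * (d * e))) ≡ a * b * c * d * e
  regroup = solve-∀

-- n ≍ X^M and T ≍ X^K, so (2n + 2)^k ≍ X^(M(K-1)) is smaller than T^M ≍ X^(KM).
3*[2n+2]^k≤T^M : ∀ {X T n Lz} k M′ → 1 ≤ X → 1 ≤ n → n ≤ Lz * X ^ suc M′ → X ^ suc k ≤ 2 * T →
  2 ^ suc M′ * 3 * (4 * Lz) ^ k ≤ X →
  3 * (2 * n + 2) ^ k ≤ T ^ suc M′
3*[2n+2]^k≤T^M {X} {T} {n} {Lz} k M′ X≥1 n≥1 n≤ X^K≤ C≤X = *-cancelˡ-≤ (2 ^ M) {{m^n≢0 2 M}} (begin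
  2 ^ M * (3 * (2 * n + 2) ^ k)        ≤⟨ *-monoʳ-≤ (2 ^ M) (*-monoʳ-≤ 3 (^-monoˡ-≤ k 2n+2≤)) ⟩
  2 ^ M * (3 * (4 * Lz * Y) ^ k)       ≡⟨ cong (λ w → 2 ^ M * (3 * w)) (^-distribʳ-* (4 * Lz) Y k) ⟩
  2 ^ M * (3 * ((4 * Lz) ^ k * Y ^ k)) ≡⟨ regroup (2 ^ M) ((4 * Lz) ^ k) (Y ^ k) ⟩
  2 ^ M * 3 * (4 * Lz) ^ k * Y ^ k     ≤⟨ *-monoˡ-≤ (Y ^ k) (≤-trans C≤X (X≤X^suc M′ X≥1)) ⟩
  Y * Y ^ k                            ≡⟨ ^-comm X (suc k) M ⟨
  (X ^ suc k) ^ M                      ≤⟨ ^-monoˡ-≤ M X^K≤ ⟩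
  (2 * T) ^ M                          ≡⟨ ^-distribʳ-* 2 T M ⟩
  2 ^ M * T ^ M                        ∎)
  where
  open ≤-Reasoning
  M Y : ℕ
  M = suc M′
  Y = X ^ M
  regroup : ∀ a c y → a * (3 * (c * y)) ≡ a * 3 * c * y
  regroup = solve-∀
  double : ∀ n → 4 * n ≡ 2 * n + 2 * n
  double = solve-∀
  2n+2≤ : 2 * n + 2 ≤ 4 * Lz * Y
  2n+2≤ = begin
    2 * n + 2     ≤⟨ +-monoʳ-≤ (2 * n) (*-monoʳ-≤ 2 n≥1) ⟩
    2 * n + 2 * n ≡⟨ double n ⟨
    4 * n         ≤⟨ *-monoʳ-≤ 4 n≤ ⟩
    4 * (Lz * Y)  ≡⟨ *-assoc 4 Lz Y ⟨
    4 * Lz * Y    ∎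

pell-family-degrees : ∀ {D dt du} (T U : ℕ → ℕ) → 1 ≤ D → (∀ X → Quadratic.IsPell D (T X , U X)) →
  GrowsLike T dt → GrowsLike U du → dt ≡ du
pell-family-degrees {D} {dt} {du} T U D≥1 pell (Lt , T≍) (Lu , U≍) = ≤-antisym
  (degree-mono (2 * ((1 + D) * Lu)) (eventually-map T-bound (eventually-× T≍ (eventually-× U≍ (growsLike⇒≥1 {d = du} (Lu , U≍))))))
  (degree-mono (2 * Lt) (eventually-map U-bound (eventually-× U≍ T≍)))
  where
  open ≤-Reasoning
  T-bound : ∀ {X} → (X ^ dt ≤ 2 * T X × _) × (_ × U X ≤ Lu * X ^ du) × 1 ≤ U X →
    X ^ dt ≤ 2 * ((1 + D) * Lu) * X ^ du
  T-bound {X} ((X^dt≤ , _) , (_ , U≤) , U≥1) = begin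
    X ^ dt                        ≤⟨ X^dt≤ ⟩
    2 * T X                       ≤⟨ *-monoʳ-≤ 2 (Quadratic.IsPell⇒a≤m*b D {1 + D} (m≤m*n (1 + D) (1 + D)) U≥1 (pell X)) ⟩
    2 * ((1 + D) * U X)           ≤⟨ *-monoʳ-≤ 2 (*-monoʳ-≤ (1 + D) U≤) ⟩
    2 * ((1 + D) * (Lu * X ^ du)) ≡⟨ regroup 2 (1 + D) Lu (X ^ du) ⟩
    2 * ((1 + D) * Lu) * X ^ du   ∎
    where
    regroup : ∀ a b c d → a * (b * (c * d)) ≡ a * (b * c) * d
    regroup = solve-∀
  U-bound : ∀ {X} → (X ^ du ≤ 2 * U X × _) × (_ × T X ≤ Lt * X ^ dt) → X ^ du ≤ 2 * Lt * X ^ dt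
  U-bound {X} ((X^du≤ , _) , (_ , T≤)) = begin
    X ^ du            ≤⟨ X^du≤ ⟩
    2 * U X           ≤⟨ *-monoʳ-≤ 2 (≤-trans (≤-reflexive (sym (*-identityˡ (U X))))
                                               (Quadratic.IsPell⇒n*b≤a D {1} D≥1 (pell X))) ⟩
    2 * T X           ≤⟨ *-monoʳ-≤ 2 T≤ ⟩
    2 * (Lt * X ^ dt) ≡⟨ *-assoc 2 Lt _ ⟨
    2 * Lt * X ^ dt   ∎

no-close-unit-power : ∀ {n T U} k M′ → ¬ 3 ℕ.∣ n → Quadratic.IsPell (n * n + 3) (T , U) → 1 ≤ U →
  3 ^ suc k * (2 * T) ^ suc M′ < n * n * n ^ k → 3 * (2 * n + 2) ^ k ≤ T ^ suc M′ → ⊥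
no-close-unit-power {zero}  k M′ 3∤0 = ⊥-elim (3∤0 (ℕ.divides 0 refl))
no-close-unit-power {suc m} k M′     = NormMinusThree.no-close-unit-power m k M′

pell-family-contradiction : ∀ {M′ dt} (n T U : ℕ → ℕ) →
  (∀ X → Quadratic.IsPell (n X * n X + 3) (T X , U X)) →
  GrowsLike n (suc M′) → GrowsLike T dt → Eventually (λ X → 1 ≤ U X) →
  (∀ {P} → Eventually P → ∃ λ X → P X × ¬ 3 ℕ.∣ n X) → ⊥
pell-family-contradiction {M′} {zero} n T U pell (_ , n≍) (Lt , T≍) U≥1 _ =
  0≢1+n (sym (n≤0⇒n≡0 (degree-mono {suc M′} {0} (2 * Lt)
    (eventually-map n-bound (eventually-× n≍ (eventually-× T≍ U≥1))))))
  where
  open ≤-Reasoning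
  n-bound : ∀ {X} → (X ^ suc M′ ≤ 2 * n X × _) × (_ × T X ≤ Lt * 1) × 1 ≤ U X → X ^ suc M′ ≤ 2 * Lt * 1
  n-bound {X} ((X^M≤ , _) , (_ , T≤) , U≥1) = begin
    X ^ suc M′   ≤⟨ X^M≤ ⟩
    2 * n X      ≤⟨ *-monoʳ-≤ 2 (≤-trans (m≤m*n (n X) (U X) {{>-nonZero U≥1}})
                                           (Quadratic.IsPell⇒n*b≤a (n X * n X + 3) {n X} (m≤m+n _ 3) (pell X))) ⟩
    2 * T X      ≤⟨ *-monoʳ-≤ 2 T≤ ⟩
    2 * (Lt * 1) ≡⟨ *-assoc 2 Lt 1 ⟨
    2 * Lt * 1   ∎
pell-family-contradiction {M′} {suc k} n T U pell (Lz , n≍) (Lt , T≍) U≥1 choose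
  with choose estimates
  where
  C₁ C₂ : ℕ
  C₁ = 2 ^ suc (suc k) * 3 ^ suc k * 2 ^ suc M′ * Lt ^ suc M′
  C₂ = 2 ^ suc M′ * 3 * (4 * Lz) ^ k
  Estimates : ℕ → Set
  Estimates X = ((X ^ suc M′ ≤ 2 * n X × n X ≤ Lz * X ^ suc M′) × (X ^ suc k ≤ 2 * T X × T X ≤ Lt * X ^ suc k))
              × (1 ≤ U X × 1 ≤ X) × (C₁ < X × C₂ < X)
  estimates : Eventually Estimates
  estimates = eventually-× (eventually-× n≍ T≍)
                (eventually-× (eventually-× U≥1 eventually-≥1) (eventually-× (eventually-> C₁) (eventually-> C₂)))
... | X , (((X^M≤ , n≤) , (X^K≤ , T≤)) , (U≥1 , X≥1) , (C₁<X , C₂<X)) , 3∤n =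
  no-close-unit-power k M′ 3∤n (pell X) U≥1
    (3^K*[2T]^M<n^[K+1] {X} {T X} {n X} {Lt} k M′ X≥1 T≤ X^M≤ C₁<X)
    (3*[2n+2]^k≤T^M {X} {T X} {n X} {Lz} k M′ X≥1 (3∤⇒≥1 3∤n) n≤ X^K≤ (<⇒≤ C₂<X))
  where
  3∤⇒≥1 : ∀ {m} → ¬ 3 ℕ.∣ m → 1 ≤ m
  3∤⇒≥1 {zero}  3∤0 = ⊥-elim (3∤0 (ℕ.divides 0 refl))
  3∤⇒≥1 {suc m} _   = s≤s z≤n

-- The surface and the curve

+∣i∣*+∣i∣≡i*i : ∀ i → + ∣ i ∣ ℤ.* + ∣ i ∣ ≡ i ℤ.* i
+∣i∣*+∣i∣≡i*i (+ n)    = refl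
+∣i∣*+∣i∣≡i*i -[1+ n ] = refl

disc≡ : ∀ z → disc z ≡ + (∣ z ∣ * ∣ z ∣ + 3)
disc≡ z = begin
  z ℤ.* z ℤ.+ + 3             ≡⟨ cong (ℤ._+ + 3) (+∣i∣*+∣i∣≡i*i z) ⟨
  + ∣ z ∣ ℤ.* + ∣ z ∣ ℤ.+ + 3 ≡⟨ cong (ℤ._+ + 3) (ℤ.pos-* ∣ z ∣ ∣ z ∣) ⟨
  + (∣ z ∣ * ∣ z ∣) ℤ.+ + 3   ≡⟨ ℤ.pos-+ (∣ z ∣ * ∣ z ∣) 3 ⟨
  + (∣ z ∣ * ∣ z ∣ + 3)       ∎
  where open ≡-Reasoning

OnSurface⇒IsPell : ∀ {t u z} → OnSurface t u z → Quadratic.IsPell (∣ z ∣ * ∣ z ∣ + 3) (∣ t ∣ , ∣ u ∣)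
OnSurface⇒IsPell {t} {u} {z} surface = Quadratic.norm≡1⇒IsPell _ (begin
  + ∣ t ∣ ℤ.* + ∣ t ∣ ℤ.- + (∣ z ∣ * ∣ z ∣ + 3) ℤ.* (+ ∣ u ∣ ℤ.* + ∣ u ∣)
    ≡⟨ cong₂ (λ a b → a ℤ.- b) (+∣i∣*+∣i∣≡i*i t) (cong₂ ℤ._*_ (sym (disc≡ z)) (+∣i∣*+∣i∣≡i*i u)) ⟩
  t ℤ.* t ℤ.- disc z ℤ.* (u ℤ.* u)
    ≡⟨ surface ⟩
  1ℤ ∎)
  where open ≡-Reasoning

square-ratio⇒square : ∀ {A B D} → 1 ≤ B → A * A ≡ D * (B * B) → ∃ λ r → r * r ≡ D
square-ratio⇒square {A} {B} {D} B≥1 A²≡DB² = A′ , (begin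
  A′ * A′       ≡⟨ reduced ⟩
  D * (B′ * B′) ≡⟨ cong (λ b → D * (b * b)) B′≡1 ⟩
  D * 1         ≡⟨ *-identityʳ D ⟩
  D             ∎)
  where
  open ≡-Reasoning
  g : ℕ
  g = gcd B A
  instance
    g≢0 : NonZero g
    g≢0 = ≢-nonZero (gcd[m,n]≢0 B A (inj₁ (λ B≡0 → <⇒≱ B≥1 (≤-reflexive B≡0))))
  A′ B′ : ℕ
  A′ = A / g
  B′ = B / g
  reduced : A′ * A′ ≡ D * (B′ * B′)
  reduced = *-cancelʳ-≡ (A′ * A′) (D * (B′ * B′)) (g * g) {{m*n≢0 g g}} (begin
    A′ * A′ * (g * g)       ≡⟨ m*n*[m*n]≡m*m*[n*n] A′ g ⟨
    A′ * g * (A′ * g)       ≡⟨ cong₂ _*_ (m/n*n≡m (gcd[m,n]∣n B A)) (m/n*n≡m (gcd[m,n]∣n B A)) ⟩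
    A * A                   ≡⟨ A²≡DB² ⟩
    D * (B * B)             ≡⟨ cong (λ b → D * (b * b)) (m/n*n≡m (gcd[m,n]∣m B A)) ⟨
    D * (B′ * g * (B′ * g)) ≡⟨ regroup′ D B′ g ⟩
    D * (B′ * B′) * (g * g) ∎)
    where
    regroup′ : ∀ D b g → D * (b * g * (b * g)) ≡ D * (b * b) * (g * g)
    regroup′ = solve-∀
  coprime : Coprime B′ A′
  coprime = coprime-/gcd B A
  B′≡1 : B′ ≡ 1
  B′≡1 = coprime (ℕ.∣-refl , coprime-divisor coprime (ℕ.divides (D * B′) (trans reduced (sym (*-assoc D B′ B′)))))

SquareFree-disc⇒¬square : ∀ z → SquareFree (disc z) → ¬ ∃ λ r → r * r ≡ ∣ z ∣ * ∣ z ∣ + 3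
SquareFree-disc⇒¬square z squareFree (r , r²≡) with squareFree (+ r) (ℕ.divides 1 r²∣disc)
  where
  r²∣disc : ∣ disc z ∣ ≡ 1 * ∣ + r ℤ.* + r ∣
  r²∣disc = trans (cong ∣_∣ (disc≡ z)) (trans (sym r²≡) (sym (trans (*-identityˡ _) (ℤ.abs-* (+ r) (+ r)))))
... | inj₁ refl = <⇒≱ (s≤s (s≤s z≤n)) (≤-trans (m≤n+m 3 (∣ z ∣ * ∣ z ∣)) (≤-reflexive (sym r²≡)))
... | inj₂ ()

residue-point : ∀ x₀ B → ∃ λ X → ∃ λ j → B ≤ X × + X ≡ x₀ ℤ.+ + (3 * j)
residue-point (+ a)      B = a + 3 * B , B , ≤-trans (m≤n*m B 3) (m≤n+m (3 * B) a) , ℤ.pos-+ a (3 * B)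
residue-point -[1+ a ]   B = 2 * suc a + 3 * B , suc a + B , ≤-trans (m≤n*m B 3) (m≤n+m (3 * B) (2 * suc a)) , (begin
  + (2 * suc a + 3 * B)                     ≡⟨ trans (ℤ.pos-+ (2 * suc a) (3 * B)) (cong₂ ℤ._+_ (ℤ.pos-* 2 (suc a)) (ℤ.pos-* 3 B)) ⟩
  + 2 ℤ.* + suc a ℤ.+ + 3 ℤ.* + B           ≡⟨ shift (+ suc a) (+ B) ⟨
  ℤ.- + suc a ℤ.+ + 3 ℤ.* (+ suc a ℤ.+ + B) ≡⟨ cong (λ w → -[1+ a ] ℤ.+ + 3 ℤ.* w) (ℤ.pos-+ (suc a) B) ⟨
  -[1+ a ] ℤ.+ + 3 ℤ.* + (suc a + B)        ≡⟨ cong (λ w → -[1+ a ] ℤ.+ w) (ℤ.pos-* 3 (suc a + B)) ⟨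
  -[1+ a ] ℤ.+ + (3 * (suc a + B))          ∎)
  where
  open ≡-Reasoning
  shift : ∀ s b → ℤ.- s ℤ.+ + 3 ℤ.* (s ℤ.+ b) ≡ + 2 ℤ.* s ℤ.+ + 3 ℤ.* b
  shift = ℤ-Solver.solve-∀

-- p(x₀ + 3j) ≡ p(x₀) (mod 3)
choose-3∤-point : ∀ p x₀ → ¬ + 3 ∣ eval p x₀ → ∀ {P} → Eventually P → ∃ λ X → P X × ¬ + 3 ∣ eval p (+ X)
choose-3∤-point p x₀ 3∤p[x₀] (B , ev) with residue-point x₀ B
... | X , j , B≤X , X≡ with eval-translate p x₀ (+ (3 * j))
...   | q , translated = X , ev X B≤X , λ 3∣p[X] → 3∤p[x₀] (ℤ∣.∣⇒∣ᵤ (ℤ∣.∣m+n∣n⇒∣m {+ 3} {eval p x₀} (3∣sum 3∣p[X]) 3∣3j*q))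
  where
  3∣sum : + 3 ∣ eval p (+ X) → + 3 ℤ∣.∣ eval p x₀ ℤ.+ + (3 * j) ℤ.* q
  3∣sum 3∣p[X] = subst (ℤ∣._∣_ (+ 3)) (trans (cong (eval p) X≡) translated) (ℤ∣.∣ᵤ⇒∣ 3∣p[X])
  3∣3j*q : + 3 ℤ∣.∣ + (3 * j) ℤ.* q
  3∣3j*q = ℤ∣.∣m⇒∣m*n q (subst (ℤ∣._∣_ (+ 3)) (sym (ℤ.pos-* 3 j)) (ℤ∣.∣m⇒∣m*n (+ j) (ℤ∣.∣-refl {+ 3})))

module OnCurve (C : A1Curve) where
  open A1Curve C
  open LeadingTerm using (degree; coeff; coeff≢0; asymptotic; degree≡0⇒IsConstant)

  T U N : ℕ → ℕ
  T X = ∣ eval tp (+ X) ∣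
  U X = ∣ eval up (+ X) ∣
  N X = ∣ eval zp (+ X) ∣

  pell-on-curve : ∀ X → Quadratic.IsPell (N X * N X + 3) (T X , U X)
  pell-on-curve X = OnSurface⇒IsPell {eval tp (+ X)} {eval up (+ X)} {eval zp (+ X)} (onSurface-eval C (+ X))

  ¬IsZero-tp : ¬ IsZero tp
  ¬IsZero-tp t≡0 =
    <⇒≱ (Quadratic.IsPell⇒1≤a _ (pell-on-curve 0)) (≤-reflexive (cong ∣_∣ (IsZero⇒eval≡0 t≡0 (+ 0))))

  nonconstant-z-impossible : ∀ {x₀ M′} → ¬ + 3 ∣ eval zp x₀ → (lz : LeadingTerm zp) → degree lz ≡ suc M′ →
    LeadingTerm tp → LeadingTerm up → ⊥
  nonconstant-z-impossible {x₀} {M′} 3∤z[x₀] lz deg≡ lt lu =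
    pell-family-contradiction {M′} {degree lt} N T U pell-on-curve
      (subst (GrowsLike N) deg≡ (growsLike lz)) (growsLike lt) (growsLike⇒≥1 {d = degree lu} (growsLike lu))
      (choose-3∤-point zp x₀ 3∤z[x₀])

  constant-z-impossible : ∀ {x₀} → IsConstant zp → SquareFree (disc (eval zp x₀)) → LeadingTerm tp → LeadingTerm up → ⊥
  constant-z-impossible {x₀} z-const squareFree lt lu = same-degree (degree lt) refl degrees≡
    where
    z₀ : ℤ
    z₀ = eval zp x₀
    D : ℕ
    D = ∣ z₀ ∣ * ∣ z₀ ∣ + 3
    z≡z₀ : ∀ X → eval zp (+ X) ≡ z₀
    z≡z₀ X = IsConstant⇒eval≡ zp z-const (+ X) x₀
    pell : ∀ X → Quadratic.IsPell D (T X , U X)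
    pell X = subst (λ z → Quadratic.IsPell (∣ z ∣ * ∣ z ∣ + 3) (T X , U X)) (z≡z₀ X) (pell-on-curve X)
    degrees≡ : degree lt ≡ degree lu
    degrees≡ = pell-family-degrees T U (≤-trans (s≤s z≤n) (m≤n+m 3 _)) pell (growsLike lt) (growsLike lu)
    same-degree : ∀ d → degree lt ≡ d → degree lt ≡ degree lu → ⊥
    same-degree zero    dt≡0 dt≡du = nonconst (degree≡0⇒IsConstant lt dt≡0 ,
                                               degree≡0⇒IsConstant lu (trans (sym dt≡du) dt≡0) , z-const)
    same-degree (suc d) dt≡ dt≡du =
      SquareFree-disc⇒¬square z₀ squareFree (square-ratio⇒square {∣ a ∣} (coeff≢0 lu) leading-abs)
      where
      a b : ℤ
      a = coeff lt
      b = coeff lu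
      leading : a ℤ.* a ≡ disc z₀ ℤ.* (b ℤ.* b)
      leading = pell-leading-coefficients (disc z₀)
        (λ X → subst (OnSurface (eval tp (+ X)) (eval up (+ X))) (z≡z₀ X) (onSurface-eval C (+ X)))
        (subst (Asymptotic _ a) dt≡ (asymptotic lt)) (subst (Asymptotic _ b) (trans (sym dt≡du) dt≡) (asymptotic lu))
      leading-abs : ∣ a ∣ * ∣ a ∣ ≡ D * (∣ b ∣ * ∣ b ∣)
      leading-abs = begin
        ∣ a ∣ * ∣ a ∣             ≡⟨ ℤ.abs-* a a ⟨
        ∣ a ℤ.* a ∣               ≡⟨ cong ∣_∣ leading ⟩
        ∣ disc z₀ ℤ.* (b ℤ.* b) ∣ ≡⟨ ℤ.abs-* (disc z₀) _ ⟩
        ∣ disc z₀ ∣ * ∣ b ℤ.* b ∣ ≡⟨ cong₂ _*_ (cong ∣_∣ (disc≡ z₀)) (ℤ.abs-* b b) ⟩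
        D * (∣ b ∣ * ∣ b ∣)       ∎
        where open ≡-Reasoning

  curve-impossible : ∀ {x₀} → ¬ + 3 ∣ eval zp x₀ → SquareFree (disc (eval zp x₀)) →
    LeadingTerm tp → LeadingTerm up → LeadingTerm zp → ⊥
  curve-impossible 3∤z[x₀] squareFree lt lu lz with degree lz in deg≡
  ... | zero   = constant-z-impossible (degree≡0⇒IsConstant lz deg≡) squareFree lt lu
  ... | suc M′ = nonconstant-z-impossible 3∤z[x₀] lz deg≡ lt lu

proposition3p1 : (t u z₀ : ℤ) → OnSurface t u z₀ → ¬ ((+ 3) ∣ z₀) →
    SquareFree (disc z₀) → ¬ (u ≡ 0ℤ) →
    (C : A1Curve) → ¬ LiesOn t u z₀ C
-- The surface hypothesis is redundant: the point lies on C, and C lies on the surface.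
proposition3p1 _ _ _ _ 3∤z₀ squareFree u≢0 C (x₀ , refl , refl , refl)
  with leadingTerm tp | leadingTerm up | leadingTerm zp
  where open A1Curve C
... | inj₁ t≡0 | _        | _        = OnCurve.¬IsZero-tp C t≡0
... | _        | inj₁ u≡0 | _        = u≢0 (IsZero⇒eval≡0 u≡0 x₀)
... | _        | _        | inj₁ z≡0 = 3∤z₀ (subst (λ z → + 3 ∣ z) (sym (IsZero⇒eval≡0 z≡0 x₀)) (ℕ.divides 0 refl))
... | inj₂ lt  | inj₂ lu  | inj₂ lz  = OnCurve.curve-impossible C 3∤z₀ squareFree lt lu lz
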